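{- Let $\theta$ be a type of shape $S$. If row $a$ is dominant in $\theta$, then the map $T\mapsto T\!\downarrow_a$ is a bijection from $\mathrm{Tab}(\theta)$ onto $\mathrm{Tab}(\theta\!\downarrow_a)$. If column $b$ is dominant in $\theta$, then the map $T\mapsto\overrightarrow{T}^b$ is a bijection from $\mathrm{Tab}(\theta)$ onto $\mathrm{Tab}(\overrightarrow{\theta}^b)$.
   Context: A diagram is a finite subset $S\subset\mathbb N_{>0}^2$; $(a,b)$ is the box in row $a$ (top to bottom), column $b$ (left to right). Arm $A_S(a,b)=\{(a,k)\in S:k>b\}$, leg $L_S(a,b)=\{(k,b)\in S:k\ge a\}$, hook $H_S=A_S\cup L_S$, $h_S=|H_S|$. A tableau of shape $S$ ($|S|=n$) is a bijection $t:S\to\{1,\dots,n\}$. A type of shape $S$ is a map $\theta:S\to\mathbb Z$ with $0\le\theta\le h_S-1$. The type of a tableau $T$ is $\mathfrak c\mapsto|\{\mathfrak d\in H_S(\mathfrak c):t_{\mathfrak d}<t_{\mathfrak c}\}|$; $\mathrm{Tab}(\theta)$ is the set of tableaux of shape $S$ of type $\theta$. $S\!\downarrow_a$ (resp. $\overrightarrow{S}^b$) is the diagram obtained from $S$ by exchanging rows $a$ and $a+1$ (resp. columns $b$ and $b+1$); $T\!\downarrow_a$ (resp. $\overrightarrow T^b$) is the tableau of that shape obtained from $T$ by exchanging rows $a$ and $a+1$ (resp. columns $b$ and $b+1$) together with their entries. Row $a$ is dominant in $\theta$ if for every $(a,y)\in S$, $(a+1,y)\in S$ and $\theta(a,y)>\theta(a+1,y)$;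 then $\theta\!\downarrow_a$ is the type of shape $S\!\downarrow_a$ obtained by decreasing every entry of row $a$ by one and then exchanging rows $a$ and $a+1$ (other entries unchanged). Column $b$ is dominant if for every $(x,b)\in S$, $(x,b+1)\in S$ and $\theta(x,b)>\theta(x,b+1)$; then $\overrightarrow{\theta}^b$ is obtained by decreasing every entry of column $b$ by one and then exchanging columns $b$ and $b+1$. -}

module Defs where

open import Data.Nat using (ℕ; suc; _≤_; _<_; _≟_; _<?_; _≤?_)
open import Data.Integer as ℤ using (ℤ; +_)
open import Data.Product using (_×_; _,_; ∃-syntax)
open import Data.Sum using (_⊎_)
open import Data.List using (List; map; length; filter)
open import Data.List.Membership.Propositional using (_∈_)
open import Relation.Binary.PropositionalEquality using (_≡_)
open import Relation.Nullary using (Dec; yes; no)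
open import Relation.Nullary.Decidable using (_×-dec_; _⊎-dec_)

-- A box (a , b): row a (top to bottom), column b (left to right).
Box : Set
Box = ℕ × ℕ

-- A diagram is a finite subset of ℕ>0²: represented as a duplicate-free
-- list of boxes with positive coordinates (hypotheses imposed in the theorem).
Diagram : Set
Diagram = List Box

Positive : Box → Set
Positive (a , b) = 1 ≤ a × 1 ≤ b

-- d ∈ H_S(c) (given d ∈ S): d in the arm of c, or d in the leg of c.
InHook : Box → Box → Set
InHook (a , b) (x , y) = (x ≡ a × b < y) ⊎ (y ≡ b × a ≤ x)

inHook? : (c d : Box) → Dec (InHook c d)
inHook? (a , b) (x , y) = (x ≟ a ×-dec b <? y) ⊎-dec (y ≟ b ×-dec a ≤? x)

hook : Diagram → Box → ℕ
hook S c = length (filter (inHook? c) S)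

IsType : Diagram → (Box → ℤ) → Set
IsType S θ = ∀ {c} → c ∈ S → + 0 ℤ.≤ θ c × θ c ℤ.≤ (+ hook S c) ℤ.- + 1

-- A tableau of shape S is a map t (only its values on S matter) restricting
-- to a bijection S → {1,…,|S|}.
IsTableau : Diagram → (Box → ℕ) → Set
IsTableau S t =
  (∀ {c d} → c ∈ S → d ∈ S → t c ≡ t d → c ≡ d) ×
  (∀ {c} → c ∈ S → 1 ≤ t c × t c ≤ length S) ×
  (∀ k → 1 ≤ k → k ≤ length S → ∃[ c ] (c ∈ S × t c ≡ k))

typeOf : Diagram → (Box → ℕ) → Box → ℕ
typeOf S t c = length (filter (λ d → inHook? c d ×-dec (t d <? t c)) S)

InTab : Diagram → (Box → ℤ) → (Box → ℕ) → Set
InTab S θ t = IsTableau S t × (∀ {c} → c ∈ S → + typeOf S t c ≡ θ c)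

TabEq : Diagram → (Box → ℕ) → (Box → ℕ) → Set
TabEq S t t' = ∀ {c} → c ∈ S → t c ≡ t' c

IsBijTab : Diagram → (Box → ℤ) → Diagram → (Box → ℤ) →
           ((Box → ℕ) → (Box → ℕ)) → Set
IsBijTab S θ S' θ' F =
  (∀ t → InTab S θ t → InTab S' θ' (F t)) ×
  (∀ t t' → InTab S θ t → InTab S θ t' → TabEq S' (F t) (F t') → TabEq S t t') ×
  (∀ t' → InTab S' θ' t' → ∃[ t ] (InTab S θ t × TabEq S' (F t) t'))

swapIdx : ℕ → ℕ → ℕ
swapIdx a x with x ≟ a
... | yes _ = suc a
... | no _ with x ≟ suc a
...   | yes _ = a
...   | no _ = x

swapRowBox : ℕ → Box → Box
swapRowBox a (x , y) = (swapIdx a x , y)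

swapColBox : ℕ → Box → Box
swapColBox b (x , y) = (x , swapIdx b y)

rowSwapDiag : ℕ → Diagram → Diagram
rowSwapDiag a S = map (swapRowBox a) S

colSwapDiag : ℕ → Diagram → Diagram
colSwapDiag b S = map (swapColBox b) S

rowSwapTab : ℕ → (Box → ℕ) → (Box → ℕ)
rowSwapTab a t c = t (swapRowBox a c)

colSwapTab : ℕ → (Box → ℕ) → (Box → ℕ)
colSwapTab b t c = t (swapColBox b c)

RowDominant : Diagram → (Box → ℤ) → ℕ → Set
RowDominant S θ a = ∀ y → (a , y) ∈ S → (suc a , y) ∈ S × θ (suc a , y) ℤ.< θ (a , y)

ColDominant : Diagram → (Box → ℤ) → ℕ → Set
ColDominant S θ b = ∀ x → (x , b) ∈ S → (x , suc b) ∈ S × θ (x , suc b) ℤ.< θ (x , b)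

rowSwapType : ℕ → (Box → ℤ) → (Box → ℤ)
rowSwapType a θ (x , y) with x ≟ suc a
... | yes _ = θ (a , y) ℤ.- + 1
... | no _ = θ (swapIdx a x , y)

colSwapType : ℕ → (Box → ℤ) → (Box → ℤ)
colSwapType b θ (x , y) with y ≟ suc b
... | yes _ = θ (x , b) ℤ.- + 1
... | no _ = θ (x , swapIdx b y)

-- Let row a be dominant in θ and T ∈ Tab(θ). Every box (a+1, y) then carries a smaller entry than
-- (a, y): otherwise, at the rightmost inversion (a, y), the exchange of rows a and a+1 maps the boxes
-- of the hook of (a, y) with smaller entries injectively to those of the hook of (a+1, y), giving
-- θ(a, y) ≤ θ(a+1, y). Given this order, the exchange removes exactly the box (a+1, y) from the
-- smaller part of the hook of (a, y) and changes no other count, so T↓a has type θ↓a. Conversely, in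
-- a tableau of type θ↓a the same comparison, now with the box itself as an extra smaller element of
-- the hook above it, forces the reversed order, so exchanging back gives a tableau of type θ.
-- Columns reduce to rows by transposition, which preserves hooks and therefore types.

module Submission where

open import Defs
open import Data.Nat as ℕ using (ℕ; suc; _⊔_; _≤_; _<_; z≤n; s≤s; s≤s⁻¹; _≟_; _<?_)
open import Data.Nat.Properties
  using (≤-refl; ≤-trans; ≤-reflexive; <-trans; <-irrefl; <-asym; <-≤-trans; ≤-<-trans;
         <⇒≤; <⇒≱; ≤∧≢⇒<; m≤n⇒m<n∨m≡n; m<1+n⇒m≤n; n≤1+n; 1+n≰n; 1+n≢n; <-cmp;
         m≤m+n; +-monoʳ-≤; +-suc; m≤m⊔n; m≤n⊔m)
open import Data.Integer as ℤ using (ℤ; +_)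
import Data.Integer.Properties as ℤP
open import Data.Product using (_×_; _,_; ∃-syntax; proj₁; proj₂)
open import Data.Product.Properties using (≡-dec)
open import Data.Sum using (_⊎_; inj₁; inj₂)
open import Data.Empty using (⊥-elim)
open import Data.List using (List; []; _∷_; _++_; map; length; filter)
open import Data.List.Properties using (length-map; length-++-sucʳ)
open import Data.List.Membership.Propositional using (_∈_; _∉_)
open import Data.List.Membership.Propositional.Properties
  using (∈-map⁺; ∈-map⁻; ∈-filter⁺; ∈-filter⁻; ∈-∃++; ∈-++⁺ˡ; ∈-++⁺ʳ; ∈-++⁻)
open import Data.List.Relation.Binary.Subset.Propositional using (_⊆_)
open import Data.List.Relation.Unary.Any using (here; there)
open import Data.List.Relation.Unary.All using (All)
import Data.List.Relation.Unary.All as All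
open import Data.List.Relation.Unary.AllPairs using (_∷_)
open import Data.List.Relation.Unary.Unique.Propositional using (Unique)
open import Data.List.Relation.Unary.Unique.Propositional.Properties
  using (filter⁺; map⁺)
open import Relation.Binary.PropositionalEquality
  using (_≡_; _≢_; refl; sym; trans; cong; subst; subst₂)
open import Relation.Binary.Definitions using (tri<; tri≈; tri>)
open import Relation.Nullary using (¬_; yes; no)
open import Relation.Nullary.Decidable using (_×-dec_)
open import Relation.Unary using (Pred; Decidable)
open import Function using (id; _∘_; _⇔_; mk⇔; Equivalence)
open import Function.Definitions using (Injective)
open import Level using (0ℓ)

count : {A : Set} {P : Pred A 0ℓ} → Decidable P → List A → ℕ
count P? xs = length (filter P? xs)

module _ {A : Set} where

  length-remove : ∀ {e : A} {ys} → e ∈ ys →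
    ∃[ ys' ] (length ys ≡ suc (length ys') × (∀ {z} → z ∈ ys → z ≢ e → z ∈ ys'))
  length-remove {e} e∈ys with ∈-∃++ e∈ys
  ... | ys₁ , ys₂ , refl = ys₁ ++ ys₂ , length-++-sucʳ ys₁ e ys₂ , keep
    where
    keep : ∀ {z} → z ∈ ys₁ ++ e ∷ ys₂ → z ≢ e → z ∈ ys₁ ++ ys₂
    keep z∈ z≢e with ∈-++⁻ ys₁ z∈
    ... | inj₁ p = ∈-++⁺ˡ p
    ... | inj₂ (here z≡e) = ⊥-elim (z≢e z≡e)
    ... | inj₂ (there p) = ∈-++⁺ʳ ys₁ p

  length-≤-⊆ : ∀ {xs ys : List A} → Unique xs → xs ⊆ ys → length xs ≤ length ys
  length-≤-⊆ {[]} _ _ = z≤n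
  length-≤-⊆ {x ∷ xs} (x∉xs ∷ uq) xs⊆ys with length-remove (xs⊆ys (here refl))
  ... | ys' , len , keep = ≤-trans (s≤s (length-≤-⊆ uq xs⊆ys')) (≤-reflexive (sym len))
    where
    xs⊆ys' : xs ⊆ ys'
    xs⊆ys' z∈xs = keep (xs⊆ys (there z∈xs)) (λ z≡x → All.lookup x∉xs z∈xs (sym z≡x))

  length-<-⊆ : ∀ {e} {xs ys : List A} → Unique xs → xs ⊆ ys → e ∈ ys → e ∉ xs →
    length xs < length ys
  length-<-⊆ {e} {xs} {ys} uq xs⊆ys e∈ys e∉xs = length-≤-⊆ (fresh ∷ uq) e∷xs⊆ys
    where
    fresh : All (e ≢_) xs
    fresh = All.tabulate (λ x∈xs e≡x → e∉xs (subst (_∈ xs) (sym e≡x) x∈xs))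
    e∷xs⊆ys : e ∷ xs ⊆ ys
    e∷xs⊆ys (here refl) = e∈ys
    e∷xs⊆ys (there x∈xs) = xs⊆ys x∈xs

module _ {A : Set} {P Q : Pred A 0ℓ} (P? : Decidable P) (Q? : Decidable Q) where

  count-cong : ∀ xs → (∀ {x} → x ∈ xs → P x → Q x) → (∀ {x} → x ∈ xs → Q x → P x) →
    count P? xs ≡ count Q? xs
  count-cong [] _ _ = refl
  count-cong (x ∷ xs) P⇒Q Q⇒P with P? x | Q? x
  ... | yes _ | yes _ = cong suc (count-cong xs (λ m → P⇒Q (there m)) (λ m → Q⇒P (there m)))
  ... | yes p | no ¬q = ⊥-elim (¬q (P⇒Q (here refl) p))
  ... | no ¬p | yes q = ⊥-elim (¬p (Q⇒P (here refl) q))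
  ... | no _ | no _ = count-cong xs (λ m → P⇒Q (there m)) (λ m → Q⇒P (there m))

  count-≡-suc : ∀ {xs e} → Unique xs → e ∈ xs → P e → ¬ Q e →
    (∀ {x} → x ∈ xs → P x → Q x ⊎ x ≡ e) → (∀ {x} → x ∈ xs → Q x → P x) →
    count P? xs ≡ suc (count Q? xs)
  count-≡-suc {x ∷ xs} (x∉xs ∷ uq) (here refl) pe ¬qe P⇒Q Q⇒P with P? x | Q? x
  ... | _ | yes q = ⊥-elim (¬qe q)
  ... | no ¬p | no _ = ⊥-elim (¬p pe)
  ... | yes _ | no _ = cong suc (count-cong xs P⇒Q' (λ m → Q⇒P (there m)))
    where
    P⇒Q' : ∀ {z} → z ∈ xs → P z → Q z
    P⇒Q' m p with P⇒Q (there m) p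
    ... | inj₁ q = q
    ... | inj₂ refl = ⊥-elim (All.lookup x∉xs m refl)
  count-≡-suc {x ∷ xs} (x∉xs ∷ uq) (there e∈xs) pe ¬qe P⇒Q Q⇒P with P? x | Q? x
  ... | yes _ | yes _ = cong suc (count-≡-suc uq e∈xs pe ¬qe (λ m → P⇒Q (there m)) (λ m → Q⇒P (there m)))
  ... | no _ | no _ = count-≡-suc uq e∈xs pe ¬qe (λ m → P⇒Q (there m)) (λ m → Q⇒P (there m))
  ... | no ¬p | yes q = ⊥-elim (¬p (Q⇒P (here refl) q))
  ... | yes p | no ¬q with P⇒Q (here refl) p
  ...   | inj₁ q = ⊥-elim (¬q q)
  ...   | inj₂ refl = ⊥-elim (All.lookup x∉xs e∈xs refl)

  module _ {xs : List A} (uq : Unique xs) {f : A → A} (f-inj : Injective _≡_ _≡_ f)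
           (f-maps : ∀ {x} → x ∈ xs → P x → f x ∈ xs × Q (f x)) where

    private
      image⊆ : map f (filter P? xs) ⊆ filter Q? xs
      image⊆ m with ∈-map⁻ f m
      ... | x , x∈ , refl with ∈-filter⁻ P? x∈
      ...   | x∈xs , px = ∈-filter⁺ Q? (proj₁ (f-maps x∈xs px)) (proj₂ (f-maps x∈xs px))

      image-unique : Unique (map f (filter P? xs))
      image-unique = map⁺ f-inj (filter⁺ P? uq)

    count-≤-injection : count P? xs ≤ count Q? xs
    count-≤-injection =
      subst (_≤ count Q? xs) (length-map f (filter P? xs)) (length-≤-⊆ image-unique image⊆)

    count-<-injection : ∀ {e} → e ∈ xs → Q e → (∀ {x} → x ∈ xs → P x → f x ≢ e) →
      count P? xs < count Q? xs
    count-<-injection {e} e∈xs qe missed =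
      subst (_< count Q? xs) (length-map f (filter P? xs))
        (length-<-⊆ image-unique image⊆ (∈-filter⁺ Q? e∈xs qe) e∉image)
      where
      e∉image : e ∉ map f (filter P? xs)
      e∉image m with ∈-map⁻ f m
      ... | x , x∈ , refl = let (x∈xs , px) = ∈-filter⁻ P? x∈ in missed x∈xs px refl

module _ {A B : Set} {P : Pred B 0ℓ} (P? : Decidable P) (f : A → B) where

  count-map : ∀ xs → count P? (map f xs) ≡ count (λ x → P? (f x)) xs
  count-map [] = refl
  count-map (x ∷ xs) with P? (f x)
  ... | yes _ = cong suc (count-map xs)
  ... | no _ = count-map xs

SmallerInHook : (Box → ℕ) → Box → Pred Box 0ℓ
SmallerInHook t c d = InHook c d × t d < t c

smallerInHook? : (t : Box → ℕ) (c : Box) → Decidable (SmallerInHook t c)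
smallerInHook? t c d = inHook? c d ×-dec (t d <? t c)

columnBound : Diagram → ℕ
columnBound [] = 0
columnBound ((_ , y) ∷ D) = suc y ⊔ columnBound D

column<columnBound : ∀ {D x y} → (x , y) ∈ D → y < columnBound D
column<columnBound {(_ , y) ∷ D} (here refl) = m≤m⊔n (suc y) (columnBound D)
column<columnBound {(_ , y) ∷ D} (there m) =
  <-≤-trans (column<columnBound m) (m≤n⊔m (suc y) (columnBound D))

descending-induction : (P : ℕ → Set) (N : ℕ) → (∀ {y} → N ≤ y → P y) →
  (∀ y → (∀ {z} → y < z → P z) → P y) → ∀ y → P y
descending-induction P N beyond step y = go N y (m≤m+n N y)
  where
  go : ∀ k y → N ≤ k ℕ.+ y → P y
  go 0 y N≤y = beyond N≤y
  go (suc k) y N≤k+y = step y λ {z} y<z →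
    go k z (≤-trans N≤k+y (≤-trans (≤-reflexive (sym (+-suc k y))) (+-monoʳ-≤ k y<z)))

+[1+n]≡i⇔+n≡i-1 : ∀ n i → (+ suc n ≡ i) ⇔ (+ n ≡ i ℤ.- + 1)
+[1+n]≡i⇔+n≡i-1 n i = mk⇔ (cong (ℤ._- + 1)) from
  where
  from : + n ≡ i ℤ.- + 1 → + suc n ≡ i
  from +n≡i-1 = trans (cong ℤ.suc (trans +n≡i-1 (ℤP.+-comm i ℤ.-1ℤ))) (ℤP.suc-pred i)

module Involution (ρ : Box → Box) (ρ-involutive : ∀ c → ρ (ρ c) ≡ c) where

  ρ-injective : Injective _≡_ _≡_ ρ
  ρ-injective {c} {d} ρc≡ρd =
    trans (sym (ρ-involutive c)) (trans (cong ρ ρc≡ρd) (ρ-involutive d))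

  ∈-map⁻-involution : ∀ {D c} → c ∈ map ρ D → ρ c ∈ D
  ∈-map⁻-involution m with ∈-map⁻ ρ m
  ... | c , c∈D , refl = subst (_∈ _) (sym (ρ-involutive c)) c∈D

  Unique-map : ∀ {D} → Unique D → Unique (map ρ D)
  Unique-map = map⁺ ρ-injective

  IsTableau-reindex : ∀ {D E u} → (∀ {c} → c ∈ E → ρ c ∈ D) → (∀ {c} → c ∈ D → ρ c ∈ E) →
    length E ≡ length D → IsTableau D u → IsTableau E (u ∘ ρ)
  IsTableau-reindex {D} {E} {u} E→D D→E |E|≡|D| (u-inj , u-range , u-onto) =
    inj , range , onto
    where
    inj : ∀ {c d} → c ∈ E → d ∈ E → u (ρ c) ≡ u (ρ d) → c ≡ d
    inj c∈E d∈E eq = ρ-injective (u-inj (E→D c∈E) (E→D d∈E) eq)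
    range : ∀ {c} → c ∈ E → 1 ≤ u (ρ c) × u (ρ c) ≤ length E
    range c∈E = let (1≤u , u≤|D|) = u-range (E→D c∈E) in 1≤u , subst (_ ≤_) (sym |E|≡|D|) u≤|D|
    onto : ∀ k → 1 ≤ k → k ≤ length E → ∃[ c ] (c ∈ E × u (ρ c) ≡ k)
    onto k 1≤k k≤|E| with u-onto k 1≤k (subst (k ≤_) |E|≡|D| k≤|E|)
    ... | c , c∈D , uc≡k = ρ c , D→E c∈D , trans (cong u (ρ-involutive c)) uc≡k

  IsTableau-map : ∀ {D u} → IsTableau D u → IsTableau (map ρ D) (u ∘ ρ)
  IsTableau-map {D} = IsTableau-reindex ∈-map⁻-involution (∈-map⁺ ρ) (length-map ρ D)

  IsTableau-unmap : ∀ {D u} → IsTableau (map ρ D) u → IsTableau D (u ∘ ρ)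
  IsTableau-unmap {D} = IsTableau-reindex (∈-map⁺ ρ) ∈-map⁻-involution (sym (length-map ρ D))

module RowExchange (a : ℕ) where

  data RowView : ℕ → Set where
    row-a : RowView a
    row-suc-a : RowView (suc a)
    row-other : ∀ {x} → x ≢ a → x ≢ suc a → RowView x

  rowView : ∀ x → RowView x
  rowView x with x ≟ a | x ≟ suc a
  ... | yes refl | _ = row-a
  ... | no _ | yes refl = row-suc-a
  ... | no x≢a | no x≢1+a = row-other x≢a x≢1+a

  swapIdx-a : swapIdx a a ≡ suc a
  swapIdx-a with a ≟ a
  ... | yes _ = refl
  ... | no a≢a = ⊥-elim (a≢a refl)

  swapIdx-suc-a : swapIdx a (suc a) ≡ a
  swapIdx-suc-a with suc a ≟ a
  ... | yes 1+a≡a = ⊥-elim (1+n≢n 1+a≡a)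
  ... | no _ with suc a ≟ suc a
  ...   | yes _ = refl
  ...   | no 1+a≢1+a = ⊥-elim (1+a≢1+a refl)

  swapIdx-other : ∀ {x} → x ≢ a → x ≢ suc a → swapIdx a x ≡ x
  swapIdx-other {x} x≢a x≢1+a with x ≟ a
  ... | yes x≡a = ⊥-elim (x≢a x≡a)
  ... | no _ with x ≟ suc a
  ...   | yes x≡1+a = ⊥-elim (x≢1+a x≡1+a)
  ...   | no _ = refl

  swapIdx-involutive : ∀ x → swapIdx a (swapIdx a x) ≡ x
  swapIdx-involutive x with rowView x
  ... | row-a = trans (cong (swapIdx a) swapIdx-a) swapIdx-suc-a
  ... | row-suc-a = trans (cong (swapIdx a) swapIdx-suc-a) swapIdx-a
  ... | row-other x≢a x≢1+a =
    trans (cong (swapIdx a) (swapIdx-other x≢a x≢1+a)) (swapIdx-other x≢a x≢1+a)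

  swapIdx-mono : ∀ {x u} → x ≤ u → swapIdx a x ≤ swapIdx a u ⊎ (x ≡ a × u ≡ suc a)
  swapIdx-mono {x} {u} x≤u with rowView x | rowView u
  ... | row-a | row-a = inj₁ ≤-refl
  ... | row-a | row-suc-a = inj₂ (refl , refl)
  ... | row-a | row-other u≢a u≢1+a rewrite swapIdx-a | swapIdx-other u≢a u≢1+a =
    inj₁ (≤∧≢⇒< x≤u (λ a≡u → u≢a (sym a≡u)))
  ... | row-suc-a | row-a = ⊥-elim (1+n≰n x≤u)
  ... | row-suc-a | row-suc-a = inj₁ ≤-refl
  ... | row-suc-a | row-other u≢a u≢1+a rewrite swapIdx-suc-a | swapIdx-other u≢a u≢1+a =
    inj₁ (≤-trans (n≤1+n a) x≤u)
  ... | row-other x≢a x≢1+a | row-a rewrite swapIdx-a | swapIdx-other x≢a x≢1+a =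
    inj₁ (≤-trans x≤u (n≤1+n a))
  ... | row-other x≢a x≢1+a | row-suc-a rewrite swapIdx-suc-a | swapIdx-other x≢a x≢1+a =
    inj₁ (m<1+n⇒m≤n (≤∧≢⇒< x≤u x≢1+a))
  ... | row-other x≢a x≢1+a | row-other u≢a u≢1+a
    rewrite swapIdx-other x≢a x≢1+a | swapIdx-other u≢a u≢1+a = inj₁ x≤u

  σ : Box → Box
  σ = swapRowBox a

  σ-involutive : ∀ c → σ (σ c) ≡ c
  σ-involutive (x , y) = cong (_, y) (swapIdx-involutive x)

  open Involution σ σ-involutive public renaming (ρ-injective to σ-injective)

  σ-a : ∀ y → σ (a , y) ≡ (suc a , y)
  σ-a y = cong (_, y) swapIdx-a

  σ-suc-a : ∀ y → σ (suc a , y) ≡ (a , y)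
  σ-suc-a y = cong (_, y) swapIdx-suc-a

  σ-moves-column-pair : ∀ {x u y} → σ (x , y) ≢ (x , y) → σ (u , y) ≢ (u , y) →
    u ≡ x ⊎ (u , y) ≡ σ (x , y)
  σ-moves-column-pair {x} {u} {y} σc≢c σd≢d with rowView x | rowView u
  ... | row-other x≢a x≢1+a | _ = ⊥-elim (σc≢c (cong (_, y) (swapIdx-other x≢a x≢1+a)))
  ... | _ | row-other u≢a u≢1+a = ⊥-elim (σd≢d (cong (_, y) (swapIdx-other u≢a u≢1+a)))
  ... | row-a | row-a = inj₁ refl
  ... | row-a | row-suc-a = inj₂ (sym (σ-a y))
  ... | row-suc-a | row-a = inj₂ (sym (σ-suc-a y))
  ... | row-suc-a | row-suc-a = inj₁ refl

  inHook-σ : ∀ c d → InHook c d → InHook (σ c) (σ d) ⊎ d ≡ σ c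
  inHook-σ (x , y) (u , v) (inj₁ (u≡x , y<v)) = inj₁ (inj₁ (cong (swapIdx a) u≡x , y<v))
  inHook-σ (x , y) (u , v) (inj₂ (v≡y , x≤u)) with swapIdx-mono x≤u
  ... | inj₁ σx≤σu = inj₁ (inj₂ (v≡y , σx≤σu))
  ... | inj₂ (refl , refl) rewrite v≡y = inj₂ (sym (σ-a y))

  inHook-σ⁻ : ∀ c d → InHook (σ c) (σ d) → InHook c d ⊎ d ≡ σ c
  inHook-σ⁻ c d h with inHook-σ (σ c) (σ d) h
  ... | inj₁ h' = inj₁ (subst₂ InHook (σ-involutive c) (σ-involutive d) h')
  ... | inj₂ σd≡σσc = inj₂ (σ-injective σd≡σσc)

  PartnersSmallerRightOf : Diagram → (Box → ℕ) → ℕ → ℕ → Set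
  PartnersSmallerRightOf D t x y =
    ∀ {z} → y < z → (x , z) ∈ D → σ (x , z) ∈ D × t (σ (x , z)) < t (x , z)

  -- σ itself is the injection: arm boxes move to the partner row, where entries are smaller by
  -- hypothesis, and the remaining leg boxes lie below both rows and are fixed.
  module HookComparison (D : Diagram) (uq : Unique D) (t : Box → ℕ) {x y : ℕ}
                        (c<σc : t (x , y) < t (σ (x , y)))
                        (partners : PartnersSmallerRightOf D t x y) where

    private
      c = (x , y)

      σc≢c : σ c ≢ c
      σc≢c σc≡c = <-irrefl (cong t (sym σc≡c)) c<σc

      σc≮c : ∀ {d} → d ≡ σ c → ¬ t d < t c
      σc≮c refl = <-asym c<σc

      partner∈D-≤ : ∀ {d} → d ∈ D → SmallerInHook t c d → σ d ∈ D × t (σ d) ≤ t d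
      partner∈D-≤ {u , v} d∈D (inj₁ (refl , y<v) , _) =
        let (σd∈D , σd<d) = partners y<v d∈D in σd∈D , <⇒≤ σd<d
      partner∈D-≤ {u , v} d∈D (inj₂ (refl , _) , d<c) with ≡-dec _≟_ _≟_ (σ (u , y)) (u , y)
      ... | yes σd≡d = subst (_∈ D) (sym σd≡d) d∈D , ≤-reflexive (cong t σd≡d)
      ... | no σd≢d with σ-moves-column-pair σc≢c σd≢d
      ...   | inj₁ refl = ⊥-elim (<-irrefl refl d<c)
      ...   | inj₂ d≡σc = ⊥-elim (σc≮c d≡σc d<c)

      σ-maps : ∀ {d} → d ∈ D → SmallerInHook t c d → σ d ∈ D × SmallerInHook t (σ c) (σ d)
      σ-maps {d} d∈D (d∈H , d<c) with inHook-σ c d d∈H | partner∈D-≤ d∈D (d∈H , d<c)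
      ... | inj₂ d≡σc | _ = ⊥-elim (σc≮c d≡σc d<c)
      ... | inj₁ σd∈Hσc | σd∈D , σd≤d = σd∈D , σd∈Hσc , ≤-<-trans σd≤d (<-trans d<c c<σc)

    hookRank-≤ : typeOf D t c ≤ typeOf D t (σ c)
    hookRank-≤ =
      count-≤-injection (smallerInHook? t c) (smallerInHook? t (σ c)) uq σ-injective σ-maps

    -- If σ c lies above c, then c is a smaller box in the hook of σ c that σ misses.
    hookRank-< : c ∈ D → InHook (σ c) c → typeOf D t c < typeOf D t (σ c)
    hookRank-< c∈D σc-hooks-c =
      count-<-injection (smallerInHook? t c) (smallerInHook? t (σ c)) uq σ-injective σ-maps c∈D
        (σc-hooks-c , c<σc) λ {d} _ (_ , d<c) σd≡c →
          σc≮c (trans (sym (σ-involutive d)) (cong σ σd≡c)) d<c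

  module _ (D : Diagram) (uq : Unique D) (t : Box → ℕ)
           (t-inj : ∀ {c d} → c ∈ D → d ∈ D → t c ≡ t d → c ≡ d) where

    partners-smaller : ∀ {x} → swapIdx a x ≢ x → (∀ {y} → (x , y) ∈ D → σ (x , y) ∈ D) →
      (∀ {y} → (x , y) ∈ D → PartnersSmallerRightOf D t x y → ¬ t (x , y) < t (σ (x , y))) →
      ∀ {y} → (x , y) ∈ D → t (σ (x , y)) < t (x , y)
    partners-smaller {x} σx≢x row⊆ no-inversion {y} =
      descending-induction Goal (columnBound D) beyond step y
      where
      Goal : ℕ → Set
      Goal y = (x , y) ∈ D → t (σ (x , y)) < t (x , y)
      beyond : ∀ {y} → columnBound D ≤ y → Goal y
      beyond N≤y c∈D = ⊥-elim (<⇒≱ (column<columnBound c∈D) N≤y)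
      step : ∀ y → (∀ {z} → y < z → Goal z) → Goal y
      step y IH c∈D with <-cmp (t (σ (x , y))) (t (x , y))
      ... | tri< σc<c _ _ = σc<c
      ... | tri≈ _ σc≡c _ = ⊥-elim (σx≢x (cong proj₁ (t-inj (row⊆ c∈D) c∈D σc≡c)))
      ... | tri> _ _ c<σc = ⊥-elim (no-inversion c∈D (λ y<z m → row⊆ m , IH y<z m) c<σc)

    row-a-partners-smaller : (∀ {y} → (a , y) ∈ D → σ (a , y) ∈ D) →
      (∀ {y} → (a , y) ∈ D → typeOf D t (σ (a , y)) < typeOf D t (a , y)) →
      ∀ {y} → (a , y) ∈ D → t (σ (a , y)) < t (a , y)
    row-a-partners-smaller row⊆ rank< =
      partners-smaller (λ σa≡a → 1+n≢n (trans (sym swapIdx-a) σa≡a)) row⊆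
        λ c∈D partners c<σc → <⇒≱ (rank< c∈D) (HookComparison.hookRank-≤ D uq t c<σc partners)

    row-suc-a-partners-smaller : (∀ {y} → (suc a , y) ∈ D → σ (suc a , y) ∈ D) →
      (∀ {y} → (suc a , y) ∈ D → typeOf D t (σ (suc a , y)) ≤ typeOf D t (suc a , y)) →
      ∀ {y} → (suc a , y) ∈ D → t (σ (suc a , y)) < t (suc a , y)
    row-suc-a-partners-smaller row⊆ rank≤ =
      partners-smaller (λ σ1+a≡1+a → 1+n≢n (trans (sym σ1+a≡1+a) swapIdx-suc-a)) row⊆
        λ c∈D partners c<σc →
          <⇒≱ (HookComparison.hookRank-< D uq t c<σc partners c∈D σc-above) (rank≤ c∈D)
      where
      σc-above : ∀ {y} → InHook (σ (suc a , y)) (suc a , y)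
      σc-above = inj₂ (refl , subst (_≤ suc a) (sym swapIdx-suc-a) (n≤1+n a))

  rowSwapType-suc-a : ∀ θ y → rowSwapType a θ (suc a , y) ≡ θ (a , y) ℤ.- + 1
  rowSwapType-suc-a θ y with suc a ≟ suc a
  ... | yes _ = refl
  ... | no 1+a≢1+a = ⊥-elim (1+a≢1+a refl)

  rowSwapType-≢ : ∀ θ {u y} → u ≢ suc a → rowSwapType a θ (u , y) ≡ θ (σ (u , y))
  rowSwapType-≢ θ {u} u≢1+a with u ≟ suc a
  ... | yes u≡1+a = ⊥-elim (u≢1+a u≡1+a)
  ... | no _ = refl

  rowSwapType-σ-a : ∀ θ y → rowSwapType a θ (σ (a , y)) ≡ θ (a , y) ℤ.- + 1
  rowSwapType-σ-a θ y = trans (cong (rowSwapType a θ) (σ-a y)) (rowSwapType-suc-a θ y)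

  rowSwapType-σ-other : ∀ θ {x y} → x ≢ a → rowSwapType a θ (σ (x , y)) ≡ θ (x , y)
  rowSwapType-σ-other θ {x} {y} x≢a =
    trans (rowSwapType-≢ θ σx≢1+a) (cong θ (σ-involutive (x , y)))
    where
    σx≢1+a : swapIdx a x ≢ suc a
    σx≢1+a σx≡1+a =
      x≢a (trans (sym (swapIdx-involutive x)) (trans (cong (swapIdx a) σx≡1+a) swapIdx-suc-a))

  -- Under the exchange only the pair (a, y), (a+1, y) changes hooks: the upper box loses the lower one
  -- from its leg, and the lower box gains the upper one, whose entry is larger.
  module TypeTransfer (S : Diagram) (uq : Unique S) (t t' : Box → ℕ) (t'∘σ≗t : ∀ d → t' (σ d) ≡ t d)
           (partners : ∀ {y} → (a , y) ∈ S → σ (a , y) ∈ S × t (σ (a , y)) < t (a , y)) where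

    private
      S' = map σ S

      SmallerInExchangedHook : Box → Pred Box 0ℓ
      SmallerInExchangedHook c d = InHook (σ c) (σ d) × t d < t c

      smallerInExchangedHook? : ∀ c → Decidable (SmallerInExchangedHook c)
      smallerInExchangedHook? c d = inHook? (σ c) (σ d) ×-dec (t d <? t c)

      typeOf-exchanged : ∀ c → typeOf S' t' (σ c) ≡ count (smallerInExchangedHook? c) S
      typeOf-exchanged c =
        trans (count-map (smallerInHook? t' (σ c)) σ S)
              (count-cong _ (smallerInExchangedHook? c) S
                 (λ {d} _ (h , lt) → h , subst₂ _<_ (t'∘σ≗t d) (t'∘σ≗t c) lt)
                 (λ {d} _ (h , lt) → h , subst₂ _<_ (sym (t'∘σ≗t d)) (sym (t'∘σ≗t c)) lt))

      σc-not-hooks-c : ∀ {y} → ¬ InHook (σ (a , y)) (σ (σ (a , y)))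
      σc-not-hooks-c {y} h with subst₂ InHook (σ-a y) (σ-involutive (a , y)) h
      ... | inj₁ (a≡1+a , _) = 1+n≢n (sym a≡1+a)
      ... | inj₂ (_ , 1+a≤a) = 1+n≰n 1+a≤a

      partner-not-smaller : ∀ {x y} → x ≢ a → σ (x , y) ∈ S → ¬ t (σ (x , y)) < t (x , y)
      partner-not-smaller {x} {y} x≢a σc∈S with rowView x
      ... | row-a = ⊥-elim (x≢a refl)
      ... | row-suc-a rewrite σ-suc-a y =
        <-asym (subst (λ e → t e < t (a , y)) (σ-a y) (proj₂ (partners σc∈S)))
      ... | row-other _ x≢1+a rewrite swapIdx-other x≢a x≢1+a = <-irrefl refl

    typeOf-exchange-row-a : ∀ {y} → (a , y) ∈ S →
      typeOf S t (a , y) ≡ suc (typeOf S' t' (σ (a , y)))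
    typeOf-exchange-row-a {y} c∈S =
      trans (count-≡-suc (smallerInHook? t c) (smallerInExchangedHook? c) uq σc∈S
               (c-hooks-σc , σc<c) (σc-not-hooks-c ∘ proj₁) P⇒Q Q⇒P)
            (cong suc (sym (typeOf-exchanged c)))
      where
      c = (a , y)
      σc∈S = proj₁ (partners c∈S)
      σc<c = proj₂ (partners c∈S)
      c-hooks-σc : InHook c (σ c)
      c-hooks-σc = inj₂ (refl , subst (a ≤_) (sym swapIdx-a) (n≤1+n a))
      P⇒Q : ∀ {d} → d ∈ S → SmallerInHook t c d → SmallerInExchangedHook c d ⊎ d ≡ σ c
      P⇒Q {d} _ (h , lt) with inHook-σ c d h
      ... | inj₁ h' = inj₁ (h' , lt)
      ... | inj₂ d≡σc = inj₂ d≡σc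
      Q⇒P : ∀ {d} → d ∈ S → SmallerInExchangedHook c d → SmallerInHook t c d
      Q⇒P {d} _ (h , lt) with inHook-σ⁻ c d h
      ... | inj₁ h' = h' , lt
      ... | inj₂ refl = ⊥-elim (σc-not-hooks-c h)

    typeOf-exchange-other : ∀ {x y} → x ≢ a → typeOf S t (x , y) ≡ typeOf S' t' (σ (x , y))
    typeOf-exchange-other {x} {y} x≢a =
      trans (count-cong (smallerInHook? t c) (smallerInExchangedHook? c) S P⇒Q Q⇒P)
            (sym (typeOf-exchanged c))
      where
      c = (x , y)
      P⇒Q : ∀ {d} → d ∈ S → SmallerInHook t c d → SmallerInExchangedHook c d
      P⇒Q {d} d∈S (h , lt) with inHook-σ c d h
      ... | inj₁ h' = h' , lt
      ... | inj₂ refl = ⊥-elim (partner-not-smaller x≢a d∈S lt)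
      Q⇒P : ∀ {d} → d ∈ S → SmallerInExchangedHook c d → SmallerInHook t c d
      Q⇒P {d} d∈S (h , lt) with inHook-σ⁻ c d h
      ... | inj₁ h' = h' , lt
      ... | inj₂ refl = ⊥-elim (partner-not-smaller x≢a d∈S lt)

    private
      typeOf-exchange-≢a : ∀ θ {x y} → x ≢ a →
        (+ typeOf S t (x , y) ≡ θ (x , y)) ⇔
        (+ typeOf S' t' (σ (x , y)) ≡ rowSwapType a θ (σ (x , y)))
      typeOf-exchange-≢a θ {x} {y} x≢a =
        subst₂ (λ n i → (+ n ≡ θ (x , y)) ⇔ (+ typeOf S' t' (σ (x , y)) ≡ i))
          (sym (typeOf-exchange-other x≢a)) (sym (rowSwapType-σ-other θ x≢a)) (mk⇔ id id)

    typeOf-exchange : ∀ θ {c} → c ∈ S →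
      (+ typeOf S t c ≡ θ c) ⇔ (+ typeOf S' t' (σ c) ≡ rowSwapType a θ (σ c))
    typeOf-exchange θ {x , y} c∈S with rowView x
    ... | row-a = subst₂ (λ n i → (+ n ≡ θ (a , y)) ⇔ (+ typeOf S' t' (σ (a , y)) ≡ i))
                    (sym (typeOf-exchange-row-a c∈S)) (sym (rowSwapType-σ-a θ y))
                    (+[1+n]≡i⇔+n≡i-1 _ _)
    ... | row-suc-a = typeOf-exchange-≢a θ 1+n≢n
    ... | row-other x≢a _ = typeOf-exchange-≢a θ x≢a

  module _ (S : Diagram) (uq : Unique S) (θ : Box → ℤ) (dom : RowDominant S θ a) where

    private
      S' = rowSwapDiag a S
      θ' = rowSwapType a θ

      dominant-partner : ∀ {y} → (a , y) ∈ S → σ (a , y) ∈ S × θ (σ (a , y)) ℤ.< θ (a , y)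
      dominant-partner {y} c∈S = subst (λ c' → c' ∈ S × θ c' ℤ.< θ (a , y)) (sym (σ-a y)) (dom y c∈S)

    rowSwapTab-InTab : ∀ t → InTab S θ t → InTab S' θ' (rowSwapTab a t)
    rowSwapTab-InTab t (tab@(t-inj , _) , t-type) = IsTableau-map tab , type'
      where
      rank< : ∀ {y} → (a , y) ∈ S → typeOf S t (σ (a , y)) < typeOf S t (a , y)
      rank< c∈S = let (σc∈S , θσc<θc) = dominant-partner c∈S in
        ℤP.drop‿+<+ (subst₂ ℤ._<_ (sym (t-type σc∈S)) (sym (t-type c∈S)) θσc<θc)
      partners : ∀ {y} → (a , y) ∈ S → σ (a , y) ∈ S × t (σ (a , y)) < t (a , y)
      partners c∈S = proj₁ (dominant-partner c∈S) ,
        row-a-partners-smaller S uq t t-inj (λ m → proj₁ (dominant-partner m)) rank< c∈S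
      open TypeTransfer S uq t (rowSwapTab a t) (λ d → cong t (σ-involutive d)) partners
      type' : ∀ {c} → c ∈ S' → + typeOf S' (rowSwapTab a t) c ≡ θ' c
      type' {c} c∈S' = subst (λ c → + typeOf S' (rowSwapTab a t) c ≡ θ' c) (σ-involutive c)
        (Equivalence.to (typeOf-exchange θ σc∈S) (t-type σc∈S))
        where σc∈S = ∈-map⁻-involution c∈S'

    rowSwapTab-injective : ∀ t u → InTab S θ t → InTab S θ u →
      TabEq S' (rowSwapTab a t) (rowSwapTab a u) → TabEq S t u
    rowSwapTab-injective t u _ _ t≡u {c} c∈S =
      subst (λ d → t d ≡ u d) (σ-involutive c) (t≡u (∈-map⁺ σ c∈S))

    rowSwapTab-surjective : ∀ t' → InTab S' θ' t' →
      ∃[ t ] (InTab S θ t × TabEq S' (rowSwapTab a t) t')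
    rowSwapTab-surjective t' (tab'@(t'-inj , _) , t'-type) =
      rowSwapTab a t' , (IsTableau-unmap tab' , type) , λ {c} _ → cong t' (σ-involutive c)
      where
      row-a∈S : ∀ {y} → (suc a , y) ∈ S' → (a , y) ∈ S
      row-a∈S {y} m = subst (_∈ S) (σ-suc-a y) (∈-map⁻-involution m)
      partner∈S' : ∀ {y} → (suc a , y) ∈ S' → σ (suc a , y) ∈ S'
      partner∈S' {y} m = ∈-map⁺ σ (proj₁ (dom y (row-a∈S m)))
      rank≤ : ∀ {y} → (suc a , y) ∈ S' →
        typeOf S' t' (σ (suc a , y)) ≤ typeOf S' t' (suc a , y)
      rank≤ {y} m = s≤s⁻¹ (ℤP.drop‿+<+ (subst₂ ℤ._<_ (sym τσc≡θσc) (sym 1+τc≡θc) θσc<θc))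
        where
        θσc<θc = proj₂ (dominant-partner (row-a∈S m))
        τσc≡θσc : + typeOf S' t' (σ (suc a , y)) ≡ θ (σ (a , y))
        τσc≡θσc = trans (t'-type (partner∈S' m))
                        (trans (cong θ' (σ-suc-a y)) (rowSwapType-≢ θ (1+n≢n ∘ sym)))
        1+τc≡θc : + suc (typeOf S' t' (suc a , y)) ≡ θ (a , y)
        1+τc≡θc = Equivalence.from (+[1+n]≡i⇔+n≡i-1 _ _)
                    (trans (t'-type m) (rowSwapType-suc-a θ y))
      partners : ∀ {y} → (a , y) ∈ S → σ (a , y) ∈ S × t' (σ (σ (a , y))) < t' (σ (a , y))
      partners {y} c∈S = proj₁ (dominant-partner c∈S) ,
        subst (λ c' → t' (σ c') < t' c') (sym (σ-a y))
          (row-suc-a-partners-smaller S' (Unique-map uq) t' t'-inj partner∈S' rank≤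
            (subst (_∈ S') (σ-a y) (∈-map⁺ σ c∈S)))
      open TypeTransfer S uq (rowSwapTab a t') t' (λ _ → refl) partners
      type : ∀ {c} → c ∈ S → + typeOf S (rowSwapTab a t') c ≡ θ c
      type c∈S = Equivalence.from (typeOf-exchange θ c∈S) (t'-type (∈-map⁺ σ c∈S))

    rowExchange : IsBijTab S θ S' θ' (rowSwapTab a)
    rowExchange = rowSwapTab-InTab , rowSwapTab-injective , rowSwapTab-surjective

transpose : Box → Box
transpose (x , y) = (y , x)

open Involution transpose (λ _ → refl) using ()
  renaming (∈-map⁻-involution to ∈-map⁻-transpose; Unique-map to Unique-transpose;
            IsTableau-map to IsTableau-transpose)

map-transpose-involutive : ∀ D → map transpose (map transpose D) ≡ D
map-transpose-involutive [] = refl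
map-transpose-involutive (c ∷ D) = cong (c ∷_) (map-transpose-involutive D)

inHook-transpose : ∀ c d → InHook (transpose c) (transpose d) → InHook c d
inHook-transpose (a , b) (x , y) (inj₁ (y≡b , a<x)) = inj₂ (y≡b , <⇒≤ a<x)
inHook-transpose (a , b) (x , y) (inj₂ (x≡a , b≤y)) with m≤n⇒m<n∨m≡n b≤y
... | inj₁ b<y = inj₁ (x≡a , b<y)
... | inj₂ refl = inj₂ (refl , ≤-reflexive (sym x≡a))

typeOf-transpose : ∀ D t c → typeOf (map transpose D) t (transpose c) ≡ typeOf D (t ∘ transpose) c
typeOf-transpose D t c =
  trans (count-map (smallerInHook? t (transpose c)) transpose D)
        (count-cong _ (smallerInHook? (t ∘ transpose) c) D
          (λ {d} _ (h , lt) → inHook-transpose c d h , lt)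
          (λ {d} _ (h , lt) → inHook-transpose (transpose c) (transpose d) h , lt))

InTab-transpose : ∀ {D θ t} → InTab D θ t → InTab (map transpose D) (θ ∘ transpose) (t ∘ transpose)
InTab-transpose {D} {θ} {t} (tab , t-type) = IsTableau-transpose tab , λ {c} c∈ →
  trans (cong +_ (typeOf-transpose D (t ∘ transpose) (transpose c))) (t-type (∈-map⁻-transpose c∈))

InTab-untranspose : ∀ {D θ t} → InTab (map transpose D) θ t → InTab D (θ ∘ transpose) (t ∘ transpose)
InTab-untranspose {D} it = subst (λ E → InTab E _ _) (map-transpose-involutive D) (InTab-transpose it)

IsBijTab-transpose : ∀ {S θ S' θ' F} → IsBijTab S θ S' θ' F →
  IsBijTab (map transpose S) (θ ∘ transpose) (map transpose S') (θ' ∘ transpose)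
           (λ t → F (t ∘ transpose) ∘ transpose)
IsBijTab-transpose {S} {θ} {S'} {θ'} {F} (F-InTab , F-injective , F-surjective) =
  InTabᵀ , injectiveᵀ , surjectiveᵀ
  where
  Sᵀ = map transpose S
  S'ᵀ = map transpose S'
  Fᵀ : (Box → ℕ) → (Box → ℕ)
  Fᵀ t = F (t ∘ transpose) ∘ transpose
  InTabᵀ : ∀ t → InTab Sᵀ (θ ∘ transpose) t → InTab S'ᵀ (θ' ∘ transpose) (Fᵀ t)
  InTabᵀ t it = InTab-transpose (F-InTab (t ∘ transpose) (InTab-untranspose it))
  injectiveᵀ : ∀ t u → InTab Sᵀ (θ ∘ transpose) t → InTab Sᵀ (θ ∘ transpose) u →
    TabEq S'ᵀ (Fᵀ t) (Fᵀ u) → TabEq Sᵀ t u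
  injectiveᵀ t u it iu t≡u c∈ =
    F-injective (t ∘ transpose) (u ∘ transpose) (InTab-untranspose it) (InTab-untranspose iu)
      (λ c∈S' → t≡u (∈-map⁺ transpose c∈S')) (∈-map⁻-transpose c∈)
  surjectiveᵀ : ∀ t' → InTab S'ᵀ (θ' ∘ transpose) t' →
    ∃[ t ] (InTab Sᵀ (θ ∘ transpose) t × TabEq S'ᵀ (Fᵀ t) t')
  surjectiveᵀ t' it' with F-surjective (t' ∘ transpose) (InTab-untranspose it')
  ... | t , it , Ft≡t' = t ∘ transpose , InTab-transpose it , λ c∈ → Ft≡t' (∈-map⁻-transpose c∈)

IsBijTab-cong-target : ∀ {S θ S' θ₁ θ₂ F} → (∀ c → θ₁ c ≡ θ₂ c) →
  IsBijTab S θ S' θ₁ F → IsBijTab S θ S' θ₂ F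
IsBijTab-cong-target θ₁≗θ₂ (F-InTab , F-injective , F-surjective) =
  (λ t it → retype θ₁≗θ₂ (F-InTab t it)) ,
  F-injective ,
  (λ t' it' → F-surjective t' (retype (sym ∘ θ₁≗θ₂) it'))
  where
  retype : ∀ {D θ θ' t} → (∀ c → θ c ≡ θ' c) → InTab D θ t → InTab D θ' t
  retype θ≗θ' (tab , t-type) = tab , λ {c} c∈ → trans (t-type c∈) (θ≗θ' c)

colSwapDiag-transpose : ∀ b S → map transpose (rowSwapDiag b (map transpose S)) ≡ colSwapDiag b S
colSwapDiag-transpose b [] = refl
colSwapDiag-transpose b (c ∷ S) = cong (swapColBox b c ∷_) (colSwapDiag-transpose b S)

colSwapType-transpose : ∀ b θ c → rowSwapType b (θ ∘ transpose) (transpose c) ≡ colSwapType b θ c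
colSwapType-transpose b θ (x , y) with y ≟ suc b
... | yes _ = refl
... | no _ = refl

colExchange : ∀ b S → Unique S → ∀ θ → ColDominant S θ b →
  IsBijTab S θ (colSwapDiag b S) (colSwapType b θ) (colSwapTab b)
colExchange b S uq θ dom =
  IsBijTab-cong-target (colSwapType-transpose b θ)
    (subst₂ (λ D D' → IsBijTab D θ D' _ (colSwapTab b))
      (map-transpose-involutive S) (colSwapDiag-transpose b S)
      (IsBijTab-transpose
        (RowExchange.rowExchange b (map transpose S) (Unique-transpose uq) (θ ∘ transpose) domᵀ)))
  where
  domᵀ : RowDominant (map transpose S) (θ ∘ transpose) b
  domᵀ y c∈ = let (c'∈S , θ<θ) = dom y (∈-map⁻-transpose c∈) in ∈-map⁺ transpose c'∈S , θ<θ

mainTheorem9 : (S : Diagram) → Unique S → All Positive S →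
    (θ : Box → ℤ) → IsType S θ →
    ((a : ℕ) → 1 ≤ a → RowDominant S θ a →
      IsBijTab S θ (rowSwapDiag a S) (rowSwapType a θ) (rowSwapTab a)) ×
    ((b : ℕ) → 1 ≤ b → ColDominant S θ b →
      IsBijTab S θ (colSwapDiag b S) (colSwapType b θ) (colSwapTab b))
mainTheorem9 S uq _ θ _ =
  (λ a _ dom → RowExchange.rowExchange a S uq θ dom) ,
  (λ b _ dom → colExchange b S uq θ dom)
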